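{- There is no bipartite distance-regular graph with diameter $4$ and valency $k$ whose set of distinct eigenvalues is $\{k,-k,0,1,-1\}$.
   Context: A connected graph of diameter $d$ is distance-regular if for any two vertices $x,y$ at distance $i$ the number of neighbours of $x$ at distance $i+1$ (resp. $i-1$) from $y$ depends only on $i$. Eigenvalues are those of the adjacency matrix. -}

module Defs where

open import Data.Bool using (Bool; true; false; _∧_; _∨_; not; if_then_else_)
open import Data.Nat using (ℕ; zero; suc; _≥_)
open import Data.Fin using (Fin; zero; suc; toℕ; punchIn; _≟_)
open import Data.List using (List; map; foldr; allFin)
open import Data.Bool.ListAction using (any)
open import Data.Integer as ℤ using (ℤ; +_; -_; _-_)
open import Data.Product using (Σ; ∃; ∃-syntax; _×_; _,_)
open import Relation.Binary.PropositionalEquality using (_≡_; _≢_)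
open import Relation.Nullary.Decidable using (⌊_⌋)

record Graph (n : ℕ) : Set where
  field
    adj   : Fin n → Fin n → Bool
    sym   : ∀ x y → adj x y ≡ adj y x
    irrefl : ∀ x → adj x x ≡ false
open Graph public

module _ {n : ℕ} (G : Graph n) where

  count : (Fin n → Bool) → ℕ
  count p = foldr Data.Nat._+_ 0 (map (λ z → if p z then 1 else 0) (allFin n))

  within : ℕ → Fin n → Fin n → Bool
  within zero    x y = ⌊ x ≟ y ⌋
  within (suc j) x y = within j x y ∨ any (λ z → adj G x z ∧ within j z y) (allFin n)

  isDist : ℕ → Fin n → Fin n → Bool
  isDist zero    x y = within zero x y
  isDist (suc i) x y = within (suc i) x y ∧ not (within i x y)

  Connected : Set
  Connected = ∀ x y → ∃[ i ] (isDist i x y ≡ true)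

  HasDiameter : ℕ → Set
  HasDiameter d = (∀ x y → within d x y ≡ true) × (∃[ x ] ∃[ y ] (isDist d x y ≡ true))

  Regular : ℕ → Set
  Regular k = ∀ x → count (adj G x) ≡ k

  Bipartite : Set
  Bipartite = Σ (Fin n → Bool) λ col → ∀ x y → adj G x y ≡ true → col x ≢ col y

  DistanceRegular : Set
  DistanceRegular =
    Connected ×
    (∀ i → ∃[ b ] ∀ x y → isDist i x y ≡ true →
        count (λ z → adj G x z ∧ isDist (suc i) z y) ≡ b) ×
    (∀ i → ∃[ c ] ∀ x y → isDist (suc i) x y ≡ true →
        count (λ z → adj G x z ∧ isDist i z y) ≡ c)

sumℤ : List ℤ → ℤ
sumℤ = foldr ℤ._+_ (+ 0)

sign : ℕ → ℤ
sign zero = + 1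
sign (suc j) = - sign j

det : ∀ {n} → (Fin n → Fin n → ℤ) → ℤ
det {zero}  M = + 1
det {suc n} M = sumℤ (map (λ j → sign (toℕ j) ℤ.* (M zero j ℤ.* det (λ i' j' → M (suc i') (punchIn j j')))) (allFin (suc n)))

adjMatrix : ∀ {n} → Graph n → Fin n → Fin n → ℤ
adjMatrix G x y = if adj G x y then + 1 else + 0

charPolyAt : ∀ {n} → Graph n → ℤ → ℤ
charPolyAt G t = det (λ x y → (if ⌊ x ≟ y ⌋ then t else + 0) - adjMatrix G x y)

-- The set of distinct eigenvalues of G is exactly {k, -k, 0, 1, -1}:
-- the characteristic polynomial is t^a (t-1)^b (t+1)^c (t-k)^d (t+k)^e with all
-- exponents ≥ 1 (identity of integer polynomials, checked at every integer t).
EigenvaluesAre0±1±k : ∀ {n} → Graph n → ℕ → Set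
EigenvaluesAre0±1±k G k =
  ∃[ a ] ∃[ b ] ∃[ c ] ∃[ d ] ∃[ e ]
    (a ≥ 1 × b ≥ 1 × c ≥ 1 × d ≥ 1 × e ≥ 1 ×
     (∀ t → charPolyAt G t ≡
        (t ℤ.^ a) ℤ.* (((t - + 1) ℤ.^ b) ℤ.* (((t ℤ.+ + 1) ℤ.^ c) ℤ.*
          (((t - + k) ℤ.^ d) ℤ.* ((t ℤ.+ + k) ℤ.^ e))))))

module Submission where

-- Let b_i, c_i be the intersection numbers, y a vertex, and Q_0 = 1, Q_1 = t,
-- Q_{i+2} = t Q_{i+1} - b_i c_{i+1} Q_i. In a bipartite distance-regular graph of diameter d the
-- vector v(w) = Q_{d(w,y)}(t) b_{d(w,y)} ⋯ b_{d-1} satisfies (tI - A) v = Q_{d+1}(t) 1_{Γ_d(y)}, so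
-- Cramer's rule at the coordinate y gives b_0 ⋯ b_{d-1} χ(t) = Q_{d+1}(t) D(t) with D(t) an integer.
-- For d = 4, Q_5(t) = t (t² - k²) (t² - θ²) with θ² = k + c_2 (b_3 - 1) and 2 ≤ θ² < k². So t² - θ²
-- divides b_0 ⋯ b_3 ∏ (t - λ)^{m_λ}, λ ∈ {0, ±1, ±k}, for every integer t. Modulo t² - θ², that is
-- in ℤ[√θ²], the product is α + β t with (α, β) ≠ 0, since its norm ∏ (λ² - θ²)^{m_λ} is nonzero;
-- and t² - θ² cannot divide a nonzero b_0 ⋯ b_3 (α + β t) once t is large.

open import Defs renaming (sym to adj-sym)
open import Algebra.Bundles using (CommutativeMonoid; Semiring)
open import Data.Bool using (Bool; true; false; _∧_; _∨_; not; if_then_else_)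
import Data.Bool.Properties as BoolP
open import Data.Bool.ListAction using (any)
open import Data.Empty using (⊥-elim)
open import Data.Fin as Fin using (Fin; zero; suc; toℕ; inject₁; punchIn; punchOut)
import Data.Fin.Properties as FinP
open import Data.Fin.Induction using (<-weakInduction)
open import Data.Integer as ℤ using (ℤ; +_; -_; _+_; _*_; _-_; _^_; ∣_∣)
import Data.Integer.Properties as ℤP
open import Data.Integer.Tactic.RingSolver using (solve-∀)
open import Data.List using (List; []; _∷_; map; foldr; allFin; tabulate)
import Data.List.Properties as ListP
open import Data.List.Membership.Propositional using (lose)
open import Data.List.Membership.Propositional.Properties using (∈-allFin)
open import Data.List.Relation.Unary.All using (All; []; _∷_)
open import Data.List.Relation.Unary.Any using (satisfied)
open import Data.List.Relation.Unary.Any.Properties using (any⁺; any⁻)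
open import Data.Nat as ℕ using (ℕ; zero; suc; pred; _∸_; _≤_; _<_; z≤n; s≤s; s≤s⁻¹)
import Data.Nat.Properties as ℕP
import Data.Nat.Tactic.RingSolver as ℕSolver
open import Data.Nat.Divisibility using (divides; ∣⇒≤)
open import Data.Product using (Σ-syntax; ∃-syntax; _×_; _,_; proj₁; proj₂)
open import Data.Sum using (_⊎_; inj₁; inj₂; [_,_]′)
open import Data.Vec.Functional using (Vector; updateAt; removeAt)
open import Data.Vec.Functional.Properties
  using (updateAt-updates; updateAt-minimal; updateAt-commutes; updateAt-id-local; updateAt-cong-local)
open import Function using (_∘_; id; const; Equivalence)
open import Relation.Binary.Definitions using (tri<; tri≈; tri>)
open import Relation.Binary.PropositionalEquality
open import Relation.Nullary using (¬_; contradiction; yes; no)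
open import Relation.Nullary.Decidable using (⌊_⌋; fromWitness; toWitness)
open import Algebra.Properties.AbelianGroup ℤP.+-0-abelianGroup using (inverseˡ-unique; inverseʳ-unique)

open Equivalence using (to; from)

punchIn-inject₁-self : ∀ {n} (a : Fin (suc n)) → punchIn (inject₁ a) a ≡ suc a
punchIn-inject₁-self zero    = refl
punchIn-inject₁-self {suc n} (suc a) = cong suc (punchIn-inject₁-self a)

inject₁≢suc : ∀ {n} (a : Fin n) → inject₁ a ≢ suc a
inject₁≢suc a eq = ℕP.1+n≢n (trans (sym (cong toℕ eq)) (FinP.toℕ-inject₁ a))

punchIn-adjacent-pair : ∀ {m} (c : Fin (suc (suc m))) (a : Fin (suc m)) → c ≢ inject₁ a → c ≢ suc a →
  Σ[ a′ ∈ Fin m ] punchIn c (inject₁ a′) ≡ inject₁ a × punchIn c (suc a′) ≡ suc a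
punchIn-adjacent-pair zero zero c≢a _ = ⊥-elim (c≢a refl)
punchIn-adjacent-pair {suc m} zero (suc a) _ _ = a , refl , refl
punchIn-adjacent-pair (suc zero) zero _ c≢sa = ⊥-elim (c≢sa refl)
punchIn-adjacent-pair {suc m} (suc (suc c)) zero _ _ = zero , refl , refl
punchIn-adjacent-pair {suc m} (suc c) (suc a) c≢a c≢sa
  with a′ , p , q ← punchIn-adjacent-pair c a (c≢a ∘ cong suc) (c≢sa ∘ cong suc)
  = suc a′ , cong suc p , cong suc q

removeAt-adjacent : ∀ {A : Set} {n} (f : Vector A (suc (suc n))) (a : Fin (suc n)) →
                    f (inject₁ a) ≡ f (suc a) → ∀ j → removeAt f (inject₁ a) j ≡ removeAt f (suc a) j
removeAt-adjacent f zero f≡ zero = sym f≡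
removeAt-adjacent f zero f≡ (suc j) = refl
removeAt-adjacent {n = suc n} f (suc a) f≡ zero = refl
removeAt-adjacent {n = suc n} f (suc a) f≡ (suc j) = removeAt-adjacent (f ∘ suc) a f≡ j

module SumProperties {c ℓ} (M : CommutativeMonoid c ℓ) where

  open CommutativeMonoid M
    using (Carrier; _≈_; _∙_; identityʳ; ∙-congˡ)
    renaming (ε to 0#; trans to ≈-trans; setoid to ≈-setoid)
  open import Algebra.Properties.CommutativeMonoid.Sum M
    using (sum; sum-cong-≋; sum-replicate-zero; sum-remove)
  open import Relation.Binary.Reasoning.Setoid ≈-setoid

  sum-zero : ∀ {n} (f : Fin n → Carrier) → (∀ i → f i ≈ 0#) → sum f ≈ 0#
  sum-zero {n} f f≈0 = ≈-trans (sum-cong-≋ f≈0) (sum-replicate-zero n)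

  sum-single : ∀ {n} (f : Fin (suc n) → Carrier) (j : Fin (suc n)) →
               (∀ i → i ≢ j → f i ≈ 0#) → sum f ≈ f j
  sum-single f j f≈0 = begin
    sum f                     ≈⟨ sum-remove f ⟩
    f j ∙ sum (removeAt f j)  ≈⟨ ∙-congˡ (sum-zero _ (λ i → f≈0 _ (FinP.punchInᵢ≢i j i))) ⟩
    f j ∙ 0#                  ≈⟨ identityʳ _ ⟩
    f j                       ∎

  sum-adjacent : ∀ {n} (f : Fin (suc (suc n)) → Carrier) (a : Fin (suc n)) →
                 (∀ i → i ≢ inject₁ a → i ≢ suc a → f i ≈ 0#) →
                 sum f ≈ f (inject₁ a) ∙ f (suc a)
  sum-adjacent f a f≈0 = begin
    sum f                                        ≈⟨ sum-remove f ⟩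
    f (inject₁ a) ∙ sum (removeAt f (inject₁ a)) ≈⟨ ∙-congˡ (sum-single _ a rest≈0) ⟩
    f (inject₁ a) ∙ f (punchIn (inject₁ a) a)    ≡⟨ cong (λ i → f (inject₁ a) ∙ f i) (punchIn-inject₁-self a) ⟩
    f (inject₁ a) ∙ f (suc a)                    ∎
    where
    rest≈0 : ∀ i → i ≢ a → removeAt f (inject₁ a) i ≈ 0#
    rest≈0 i i≢a = f≈0 _ (FinP.punchInᵢ≢i (inject₁ a) i)
      (λ eq → i≢a (FinP.punchIn-injective (inject₁ a) i a (trans eq (sym (punchIn-inject₁-self a)))))

  foldr-map-allFin : ∀ {n} (f : Fin n → Carrier) →
                     foldr _∙_ 0# (map f (allFin n)) ≡ sum f
  foldr-map-allFin {n} f = trans (cong (foldr _∙_ 0#) (ListP.map-tabulate id f)) (foldr-tabulate f)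
    where
    foldr-tabulate : ∀ {m} (g : Fin m → Carrier) → foldr _∙_ 0# (tabulate g) ≡ sum g
    foldr-tabulate {zero} g = refl
    foldr-tabulate {suc m} g = cong (g zero ∙_) (foldr-tabulate (g ∘ suc))

open import Algebra.Properties.Semiring.Sum ℤP.+-*-semiring using (sum; sum-cong-≋; ∑-distrib-+; *-distribˡ-sum)
open SumProperties (Semiring.+-commutativeMonoid ℤP.+-*-semiring) using (sum-single; sum-adjacent; foldr-map-allFin)

module ℕΣ where
  open import Algebra.Properties.Semiring.Sum ℕP.+-*-semiring public
  open SumProperties (Semiring.+-commutativeMonoid ℕP.+-*-semiring) public

sum-linear : ∀ {n} a b (f g : Vector ℤ n) → sum (λ i → a * f i + b * g i) ≡ a * sum f + b * sum g
sum-linear a b f g = begin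
  sum (λ i → a * f i + b * g i)              ≡⟨ ∑-distrib-+ (λ i → a * f i) (λ i → b * g i) ⟩
  sum (λ i → a * f i) + sum (λ i → b * g i)  ≡⟨ cong₂ _+_ (*-distribˡ-sum a f) (*-distribˡ-sum b g) ⟨
  a * sum f + b * sum g                      ∎
  where open ≡-Reasoning

-- Determinants

Matrix : ℕ → Set
Matrix n = Fin n → Fin n → ℤ

column : ∀ {n} → Matrix n → Fin n → Vector ℤ n
column M j r = M r j

minor : ∀ {n} → Matrix (suc n) → Fin (suc n) → Matrix n
minor M j r = removeAt (M (suc r)) j

laplaceTerm : ∀ {n} → Matrix (suc n) → Fin (suc n) → ℤ
laplaceTerm M j = sign (toℕ j) * (M zero j * det (minor M j))

det-laplace : ∀ {n} (M : Matrix (suc n)) → det M ≡ sum (laplaceTerm M)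
det-laplace M = foldr-map-allFin (laplaceTerm M)

det-cong : ∀ {n} {M N : Matrix n} → (∀ r c → M r c ≡ N r c) → det M ≡ det N
det-cong {zero} M≗N = refl
det-cong {suc n} {M} {N} M≗N = begin
  det M                ≡⟨ det-laplace M ⟩
  sum (laplaceTerm M)  ≡⟨ sum-cong-≋ term≗ ⟩
  sum (laplaceTerm N)  ≡⟨ det-laplace N ⟨
  det N                ∎
  where
  open ≡-Reasoning
  term≗ : ∀ j → laplaceTerm M j ≡ laplaceTerm N j
  term≗ j = cong₂ (λ x D → sign (toℕ j) * (x * D)) (M≗N zero j)
                  (det-cong (λ r c → M≗N (suc r) (punchIn j c)))

replaceCol : ∀ {n} → Matrix n → Fin n → Vector ℤ n → Matrix n
replaceCol M j g r = updateAt (M r) j (const (g r))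

replaceCol-updates : ∀ {n} (M : Matrix n) j g r → replaceCol M j g r j ≡ g r
replaceCol-updates M j g r = updateAt-updates j (M r)

replaceCol-minimal : ∀ {n} (M : Matrix n) j g r {c} → c ≢ j → replaceCol M j g r c ≡ M r c
replaceCol-minimal M j g r {c} c≢j = updateAt-minimal c j (M r) c≢j

minor-replaceCol-self : ∀ {n} (M : Matrix (suc n)) j g r c → minor (replaceCol M j g) j r c ≡ minor M j r c
minor-replaceCol-self M j g r c = replaceCol-minimal M j g (suc r) (FinP.punchInᵢ≢i j c)

minor-replaceCol-other : ∀ {n} (M : Matrix (suc n)) {i j} (i≢j : i ≢ j) g r c →
  minor (replaceCol M j g) i r c ≡ replaceCol (minor M i) (punchOut i≢j) (g ∘ suc) r c
minor-replaceCol-other M {i} {j} i≢j g r c with c Fin.≟ punchOut i≢j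
... | yes refl = begin
  replaceCol M j g (suc r) (punchIn i (punchOut i≢j))
    ≡⟨ cong (replaceCol M j g (suc r)) (FinP.punchIn-punchOut i≢j) ⟩
  replaceCol M j g (suc r) j                          ≡⟨ replaceCol-updates M j g (suc r) ⟩
  g (suc r)
    ≡⟨ replaceCol-updates (minor M i) (punchOut i≢j) (g ∘ suc) r ⟨
  replaceCol (minor M i) (punchOut i≢j) (g ∘ suc) r (punchOut i≢j) ∎
  where open ≡-Reasoning
... | no c≢j′ = begin
  replaceCol M j g (suc r) (punchIn i c) ≡⟨ replaceCol-minimal M j g (suc r) punchIn≢j ⟩
  M (suc r) (punchIn i c)                ≡⟨ replaceCol-minimal (minor M i) (punchOut i≢j) (g ∘ suc) r c≢j′ ⟨
  replaceCol (minor M i) (punchOut i≢j) (g ∘ suc) r c ∎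
  where
  open ≡-Reasoning
  punchIn≢j : punchIn i c ≢ j
  punchIn≢j eq = c≢j′ (FinP.punchIn-injective i c _ (trans eq (sym (FinP.punchIn-punchOut i≢j))))

laplaceTerm-replaceCol-self : ∀ {n} (M : Matrix (suc n)) j w →
  laplaceTerm (replaceCol M j w) j ≡ sign (toℕ j) * (w zero * det (minor M j))
laplaceTerm-replaceCol-self M j w = cong₂ (λ x D → sign (toℕ j) * (x * D)) (replaceCol-updates M j w zero)
                                          (det-cong (minor-replaceCol-self M j w))

laplaceTerm-replaceCol-other : ∀ {n} (M : Matrix (suc n)) {i j} (i≢j : i ≢ j) w →
  laplaceTerm (replaceCol M j w) i ≡ sign (toℕ i) * (M zero i * det (replaceCol (minor M i) (punchOut i≢j) (w ∘ suc)))
laplaceTerm-replaceCol-other M {i} {j} i≢j w = cong₂ (λ x D → sign (toℕ i) * (x * D)) (replaceCol-minimal M j w zero i≢j)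
                                                     (det-cong (minor-replaceCol-other M i≢j w))

det-linear : ∀ {n} (M : Matrix n) j a b (g h : Vector ℤ n) →
  det (replaceCol M j (λ r → a * g r + b * h r)) ≡ a * det (replaceCol M j g) + b * det (replaceCol M j h)
det-linear {suc n} M j a b g h = begin
  det Mu                                                  ≡⟨ det-laplace Mu ⟩
  sum (laplaceTerm Mu)                                    ≡⟨ sum-cong-≋ term-linear ⟩
  sum (λ i → a * laplaceTerm Mg i + b * laplaceTerm Mh i) ≡⟨ sum-linear a b (laplaceTerm Mg) (laplaceTerm Mh) ⟩
  a * sum (laplaceTerm Mg) + b * sum (laplaceTerm Mh)
    ≡⟨ cong₂ (λ x y → a * x + b * y) (det-laplace Mg) (det-laplace Mh) ⟨
  a * det Mg + b * det Mh                                 ∎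
  where
  open ≡-Reasoning
  u : Vector ℤ (suc n)
  u r = a * g r + b * h r
  Mu Mg Mh : Matrix (suc n)
  Mu = replaceCol M j u
  Mg = replaceCol M j g
  Mh = replaceCol M j h

  distrib-entry : ∀ s a b x y D → s * ((a * x + b * y) * D) ≡ a * (s * (x * D)) + b * (s * (y * D))
  distrib-entry = solve-∀

  distrib-minor : ∀ s a b m X Y → s * (m * (a * X + b * Y)) ≡ a * (s * (m * X)) + b * (s * (m * Y))
  distrib-minor = solve-∀

  term-linear : ∀ i → laplaceTerm Mu i ≡ a * laplaceTerm Mg i + b * laplaceTerm Mh i
  term-linear i with i Fin.≟ j
  ... | yes refl = begin
    laplaceTerm Mu i                          ≡⟨ laplaceTerm-replaceCol-self M i u ⟩
    sign (toℕ i) * (u zero * det (minor M i))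
      ≡⟨ distrib-entry (sign (toℕ i)) a b (g zero) (h zero) (det (minor M i)) ⟩
    a * (sign (toℕ i) * (g zero * det (minor M i))) + b * (sign (toℕ i) * (h zero * det (minor M i)))
      ≡⟨ cong₂ (λ x y → a * x + b * y) (laplaceTerm-replaceCol-self M i g) (laplaceTerm-replaceCol-self M i h) ⟨
    a * laplaceTerm Mg i + b * laplaceTerm Mh i ∎
  ... | no i≢j = begin
    laplaceTerm Mu i
      ≡⟨ laplaceTerm-replaceCol-other M i≢j u ⟩
    sign (toℕ i) * (M zero i * det (replaceCol (minor M i) j′ (u ∘ suc)))
      ≡⟨ cong (λ D → sign (toℕ i) * (M zero i * D)) (det-linear (minor M i) j′ a b (g ∘ suc) (h ∘ suc)) ⟩
    sign (toℕ i) * (M zero i * (a * det (replaceCol (minor M i) j′ (g ∘ suc)) + b * det (replaceCol (minor M i) j′ (h ∘ suc))))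
      ≡⟨ distrib-minor (sign (toℕ i)) a b (M zero i) _ _ ⟩
    a * (sign (toℕ i) * (M zero i * det (replaceCol (minor M i) j′ (g ∘ suc))))
      + b * (sign (toℕ i) * (M zero i * det (replaceCol (minor M i) j′ (h ∘ suc))))
      ≡⟨ cong₂ (λ x y → a * x + b * y) (laplaceTerm-replaceCol-other M i≢j g) (laplaceTerm-replaceCol-other M i≢j h) ⟨
    a * laplaceTerm Mg i + b * laplaceTerm Mh i ∎
    where j′ = punchOut i≢j

replaceCol-cong : ∀ {n} (M : Matrix n) j {g h : Vector ℤ n} → (∀ r → g r ≡ h r) →
                  ∀ r c → replaceCol M j g r c ≡ replaceCol M j h r c
replaceCol-cong M j g≗h r = updateAt-cong-local j (M r) (g≗h r)

replaceCol-commutes : ∀ {n} (M : Matrix n) {i j} → i ≢ j → ∀ x y r c →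
                      replaceCol (replaceCol M i x) j y r c ≡ replaceCol (replaceCol M j y) i x r c
replaceCol-commutes M {i} {j} i≢j x y r = updateAt-commutes j i {const (y r)} {const (x r)} (i≢j ∘ sym) (M r)

replaceCol-own : ∀ {n} (M : Matrix n) j r c → replaceCol M j (column M j) r c ≡ M r c
replaceCol-own M j r = updateAt-id-local j (M r) refl

det-additive : ∀ {n} (M : Matrix n) j (g h : Vector ℤ n) →
  det (replaceCol M j (λ r → g r + h r)) ≡ det (replaceCol M j g) + det (replaceCol M j h)
det-additive M j g h = begin
  det (replaceCol M j (λ r → g r + h r))
    ≡⟨ det-cong (replaceCol-cong M j (λ r → sym (one*+one* (g r) (h r)))) ⟩
  det (replaceCol M j (λ r → + 1 * g r + + 1 * h r))             ≡⟨ det-linear M j (+ 1) (+ 1) g h ⟩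
  + 1 * det (replaceCol M j g) + + 1 * det (replaceCol M j h)
    ≡⟨ one*+one* (det (replaceCol M j g)) (det (replaceCol M j h)) ⟩
  det (replaceCol M j g) + det (replaceCol M j h)                ∎
  where
  open ≡-Reasoning
  one*+one* : ∀ x y → + 1 * x + + 1 * y ≡ x + y
  one*+one* x y = cong₂ _+_ (ℤP.*-identityˡ x) (ℤP.*-identityˡ y)

det-homogeneous : ∀ {n} (M : Matrix n) j a (g : Vector ℤ n) →
  det (replaceCol M j (λ r → a * g r)) ≡ a * det (replaceCol M j g)
det-homogeneous M j a g = begin
  det (replaceCol M j (λ r → a * g r))
    ≡⟨ det-cong (replaceCol-cong M j (λ r → sym (+zero* (a * g r) (g r)))) ⟩
  det (replaceCol M j (λ r → a * g r + + 0 * g r))               ≡⟨ det-linear M j a (+ 0) g g ⟩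
  a * det (replaceCol M j g) + + 0 * det (replaceCol M j g)
    ≡⟨ +zero* (a * det (replaceCol M j g)) (det (replaceCol M j g)) ⟩
  a * det (replaceCol M j g)                                     ∎
  where
  open ≡-Reasoning
  +zero* : ∀ x y → x + + 0 * y ≡ x
  +zero* x y = trans (cong (λ z → x + z) (ℤP.*-zeroˡ y)) (ℤP.+-identityʳ x)

det-zero-col : ∀ {n} (M : Matrix n) j → det (replaceCol M j (const (+ 0))) ≡ + 0
det-zero-col M j = begin
  det (replaceCol M j (const (+ 0)))
    ≡⟨ det-cong (replaceCol-cong M j (λ r → sym (ℤP.*-zeroˡ (M r j)))) ⟩
  det (replaceCol M j (λ r → + 0 * M r j))        ≡⟨ det-homogeneous M j (+ 0) (column M j) ⟩
  + 0 * det (replaceCol M j (column M j))         ≡⟨ ℤP.*-zeroˡ (det (replaceCol M j (column M j))) ⟩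
  + 0                                             ∎
  where open ≡-Reasoning

det-adjacent-equal-cols : ∀ {n} (M : Matrix (suc n)) (a : Fin n) →
  (∀ r → M r (inject₁ a) ≡ M r (suc a)) → det M ≡ + 0
det-adjacent-equal-cols {suc n} M a cols≡ = begin
  det M                                              ≡⟨ det-laplace M ⟩
  sum (laplaceTerm M)                                ≡⟨ sum-adjacent (laplaceTerm M) a other-term≡0 ⟩
  laplaceTerm M (inject₁ a) + laplaceTerm M (suc a)
    ≡⟨ cong₂ (λ s x → s * x + laplaceTerm M (suc a)) (cong sign (FinP.toℕ-inject₁ a)) same-factor ⟩
  s * X + (- s) * X                                  ≡⟨ cancel s X ⟩
  + 0                                                ∎
  where
  open ≡-Reasoning
  s X : ℤ
  s = sign (toℕ a)
  X = M zero (suc a) * det (minor M (suc a))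
  same-factor : M zero (inject₁ a) * det (minor M (inject₁ a)) ≡ X
  same-factor = cong₂ _*_ (cols≡ zero) (det-cong (λ r → removeAt-adjacent (M (suc r)) a (cols≡ (suc r))))
  cancel : ∀ s X → s * X + (- s) * X ≡ + 0
  cancel = solve-∀
  other-term≡0 : ∀ c → c ≢ inject₁ a → c ≢ suc a → laplaceTerm M c ≡ + 0
  other-term≡0 c c≢a c≢sa with a′ , p , q ← punchIn-adjacent-pair c a c≢a c≢sa = begin
    sign (toℕ c) * (M zero c * det (minor M c))  ≡⟨ cong (λ D → sign (toℕ c) * (M zero c * D)) minor≡0 ⟩
    sign (toℕ c) * (M zero c * + 0)              ≡⟨ cong (sign (toℕ c) *_) (ℤP.*-zeroʳ (M zero c)) ⟩
    sign (toℕ c) * + 0                           ≡⟨ ℤP.*-zeroʳ (sign (toℕ c)) ⟩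
    + 0                                          ∎
    where
    minor≡0 : det (minor M c) ≡ + 0
    minor≡0 = det-adjacent-equal-cols (minor M c) a′
      (λ r → trans (cong (M (suc r)) p) (trans (cols≡ (suc r)) (cong (M (suc r)) (sym q))))

swapAdjacentCols : ∀ {n} → Matrix (suc n) → Fin n → Matrix (suc n)
swapAdjacentCols M a = replaceCol (replaceCol M (inject₁ a) (column M (suc a))) (suc a) (column M (inject₁ a))

det-swapAdjacentCols : ∀ {n} (M : Matrix (suc n)) (a : Fin n) → det (swapAdjacentCols M a) ≡ - det M
det-swapAdjacentCols {n} M a = inverseʳ-unique (det M) (det (swapAdjacentCols M a)) sum≡0
  where
  -- D is additive in each argument and vanishes on the diagonal, so expanding
  -- D (g + h) (g + h) = 0 leaves det M + D h g = 0.
  open ≡-Reasoning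
  i j : Fin (suc n)
  i = inject₁ a
  j = suc a
  i≢j : i ≢ j
  i≢j = inject₁≢suc a
  D : Vector ℤ (suc n) → Vector ℤ (suc n) → ℤ
  D x y = det (replaceCol (replaceCol M i x) j y)
  D-diagonal : ∀ x → D x x ≡ + 0
  D-diagonal x = det-adjacent-equal-cols (replaceCol (replaceCol M i x) j x) a (λ r →
    trans (replaceCol-minimal (replaceCol M i x) j x r i≢j)
          (trans (replaceCol-updates M i x r) (sym (replaceCol-updates (replaceCol M i x) j x r))))
  D-additiveˡ : ∀ x x′ y → D (λ r → x r + x′ r) y ≡ D x y + D x′ y
  D-additiveˡ x x′ y = begin
    D (λ r → x r + x′ r) y
      ≡⟨ det-cong (replaceCol-commutes M i≢j (λ r → x r + x′ r) y) ⟩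
    det (replaceCol (replaceCol M j y) i (λ r → x r + x′ r)) ≡⟨ det-additive (replaceCol M j y) i x x′ ⟩
    det (replaceCol (replaceCol M j y) i x) + det (replaceCol (replaceCol M j y) i x′)
      ≡⟨ cong₂ _+_ (det-cong (replaceCol-commutes M (i≢j ∘ sym) y x)) (det-cong (replaceCol-commutes M (i≢j ∘ sym) y x′)) ⟩
    D x y + D x′ y                                     ∎
  D-additiveʳ : ∀ x y y′ → D x (λ r → y r + y′ r) ≡ D x y + D x y′
  D-additiveʳ x = det-additive (replaceCol M i x) j
  g h : Vector ℤ (suc n)
  g = column M i
  h = column M j
  D-own : D g h ≡ det M
  D-own = det-cong (λ r c →
    trans (updateAt-id-local j {const (h r)} (replaceCol M i g r) (sym (replaceCol-minimal M i g r (i≢j ∘ sym))) c)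
          (replaceCol-own M i r c))
  sum≡0 : det M + det (swapAdjacentCols M a) ≡ + 0
  sum≡0 = sym (begin
    + 0                                  ≡⟨ D-diagonal (λ r → g r + h r) ⟨
    D (λ r → g r + h r) (λ r → g r + h r) ≡⟨ D-additiveˡ g h (λ r → g r + h r) ⟩
    D g (λ r → g r + h r) + D h (λ r → g r + h r) ≡⟨ cong₂ _+_ (D-additiveʳ g g h) (D-additiveʳ h g h) ⟩
    (D g g + D g h) + (D h g + D h h)
      ≡⟨ cong₂ _+_ (cong₂ _+_ (D-diagonal g) D-own) (cong (λ x → D h g + x) (D-diagonal h)) ⟩
    (+ 0 + det M) + (D h g + + 0)        ≡⟨ cong₂ _+_ (ℤP.+-identityˡ (det M)) (ℤP.+-identityʳ (D h g)) ⟩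
    det M + D h g                        ∎)

det-equal-cols-< : ∀ {n} {p q : Fin n} → p Fin.< q → (M : Matrix n) → (∀ r → M r p ≡ M r q) → det M ≡ + 0
det-equal-cols-< {suc n} {p} {q} = <-weakInduction P (λ ()) step q
  where
  -- Induction on q: swapping the columns q - 1 and q brings the equal pair closer.
  P : Fin (suc n) → Set
  P q = p Fin.< q → (M : Matrix (suc n)) → (∀ r → M r p ≡ M r q) → det M ≡ + 0
  step : ∀ j → P (inject₁ j) → P (suc j)
  step j ih p<1+j M cols≡ with p Fin.≟ inject₁ j
  ... | yes refl = det-adjacent-equal-cols M j cols≡
  ... | no p≢j = begin
    det M        ≡⟨ ℤP.neg-involutive (det M) ⟨
    - - det M    ≡⟨ cong -_ (det-swapAdjacentCols M j) ⟨
    - det N      ≡⟨ cong -_ (ih p<j N swapped-cols≡) ⟩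
    + 0          ∎
    where
    open ≡-Reasoning
    M′ N : Matrix (suc n)
    M′ = replaceCol M (inject₁ j) (column M (suc j))
    N = replaceCol M′ (suc j) (column M (inject₁ j))
    p<j : p Fin.< inject₁ j
    p<j = FinP.≤∧≢⇒< (FinP.<⇒≤pred p<1+j) p≢j
    p≢1+j : p ≢ suc j
    p≢1+j = FinP.<⇒≢ p<1+j
    swapped-cols≡ : ∀ r → N r p ≡ N r (inject₁ j)
    swapped-cols≡ r = begin
      N r p                ≡⟨ replaceCol-minimal M′ (suc j) (column M (inject₁ j)) r p≢1+j ⟩
      M′ r p               ≡⟨ replaceCol-minimal M (inject₁ j) (column M (suc j)) r p≢j ⟩
      M r p                ≡⟨ cols≡ r ⟩
      M r (suc j)          ≡⟨ replaceCol-updates M (inject₁ j) (column M (suc j)) r ⟨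
      M′ r (inject₁ j)     ≡⟨ replaceCol-minimal M′ (suc j) (column M (inject₁ j)) r (inject₁≢suc j) ⟨
      N r (inject₁ j)      ∎

det-equal-cols : ∀ {n} (M : Matrix n) {p q : Fin n} → p ≢ q → (∀ r → M r p ≡ M r q) → det M ≡ + 0
det-equal-cols M {p} {q} p≢q cols≡ with FinP.<-cmp p q
... | tri< p<q _ _ = det-equal-cols-< p<q M cols≡
... | tri≈ _ p≡q _ = ⊥-elim (p≢q p≡q)
... | tri> _ _ q<p = det-equal-cols-< q<p M (sym ∘ cols≡)

det-replaceCol-sum : ∀ {n m} (M : Matrix n) j (w : Vector ℤ m) (C : Fin m → Vector ℤ n) →
  det (replaceCol M j (λ r → sum (λ i → w i * C i r))) ≡ sum (λ i → w i * det (replaceCol M j (C i)))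
det-replaceCol-sum {m = zero} M j w C = det-zero-col M j
det-replaceCol-sum {m = suc m} M j w C = begin
  det (replaceCol M j (λ r → w zero * C zero r + rest r))
    ≡⟨ det-additive M j (λ r → w zero * C zero r) rest ⟩
  det (replaceCol M j (λ r → w zero * C zero r)) + det (replaceCol M j rest)
    ≡⟨ cong₂ _+_ (det-homogeneous M j (w zero) (C zero)) (det-replaceCol-sum M j (w ∘ suc) (C ∘ suc)) ⟩
  w zero * det (replaceCol M j (C zero)) + sum (λ i → w (suc i) * det (replaceCol M j (C (suc i)))) ∎
  where
  open ≡-Reasoning
  rest : Vector ℤ _
  rest r = sum (λ i → w (suc i) * C (suc i) r)

cramer : ∀ {n} (M : Matrix n) j (v : Vector ℤ n) →
  det (replaceCol M j (λ r → sum (λ i → v i * M r i))) ≡ v j * det M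
cramer {suc n} M j v = begin
  det (replaceCol M j (λ r → sum (λ i → v i * M r i)))    ≡⟨ det-replaceCol-sum M j v (column M) ⟩
  sum (λ i → v i * det (replaceCol M j (column M i)))
    ≡⟨ sum-single (λ i → v i * det (replaceCol M j (column M i))) j other-term≡0 ⟩
  v j * det (replaceCol M j (column M j))                 ≡⟨ cong (v j *_) (det-cong (replaceCol-own M j)) ⟩
  v j * det M                                             ∎
  where
  open ≡-Reasoning
  other-term≡0 : ∀ i → i ≢ j → v i * det (replaceCol M j (column M i)) ≡ + 0
  other-term≡0 i i≢j = trans (cong (v i *_) (det-equal-cols (replaceCol M j (column M i)) i≢j cols≡)) (ℤP.*-zeroʳ (v i))
    where
    cols≡ : ∀ r → replaceCol M j (column M i) r i ≡ replaceCol M j (column M i) r j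
    cols≡ r = trans (replaceCol-minimal M j (column M i) r i≢j) (sym (replaceCol-updates M j (column M i) r))

𝟙 : Bool → ℤ
𝟙 b = if b then + 1 else + 0

count≡sum : ∀ {n} (G : Graph n) p → count G p ≡ ℕΣ.sum (λ z → if p z then 1 else 0)
count≡sum G p = ℕΣ.foldr-map-allFin (λ z → if p z then 1 else 0)

count-ℤ : ∀ {n} (G : Graph n) p → + count G p ≡ sum (λ z → 𝟙 (p z))
count-ℤ G p = begin
  + count G p                                   ≡⟨ cong +_ (count≡sum G p) ⟩
  + ℕΣ.sum (λ z → if p z then 1 else 0)         ≡⟨ pos-sum (λ z → if p z then 1 else 0) ⟩
  sum (λ z → + (if p z then 1 else 0))          ≡⟨ sum-cong-≋ (λ z → pos-if (p z)) ⟩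
  sum (λ z → 𝟙 (p z))                           ∎
  where
  open ≡-Reasoning
  pos-sum : ∀ {m} (f : Fin m → ℕ) → + ℕΣ.sum f ≡ sum (+_ ∘ f)
  pos-sum {zero}  f = refl
  pos-sum {suc m} f = trans (ℤP.pos-+ (f zero) _) (cong (λ x → + f zero + x) (pos-sum (f ∘ suc)))
  pos-if : ∀ b → + (if b then 1 else 0) ≡ 𝟙 b
  pos-if true  = refl
  pos-if false = refl

count-zero : ∀ {n} (G : Graph n) p → (∀ z → p z ≡ false) → count G p ≡ 0
count-zero G p p≡false = trans (count≡sum G p) (ℕΣ.sum-zero _ (λ z → cong (λ b → if b then 1 else 0) (p≡false z)))

count-single : ∀ {n} (G : Graph n) p w → p w ≡ true → (∀ z → z ≢ w → p z ≡ false) → count G p ≡ 1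
count-single {suc n} G p w pw others = begin
  count G p                                  ≡⟨ count≡sum G p ⟩
  ℕΣ.sum (λ z → if p z then 1 else 0)
    ≡⟨ ℕΣ.sum-single _ w (λ z z≢w → cong (λ b → if b then 1 else 0) (others z z≢w)) ⟩
  (if p w then 1 else 0)                     ≡⟨ cong (λ b → if b then 1 else 0) pw ⟩
  1                                          ∎
  where open ≡-Reasoning

count-positive : ∀ {n} (G : Graph n) p w → p w ≡ true → 0 < count G p
count-positive {suc n} G p w pw = begin-strict
  0                                                    <⟨ s≤s z≤n ⟩
  1                                                    ≡⟨ cong (λ b → if b then 1 else 0) pw ⟨
  (if p w then 1 else 0)                               ≤⟨ ℕP.m≤m+n _ _ ⟩
  (if p w then 1 else 0) ℕ.+ ℕΣ.sum (removeAt f w)     ≡⟨ ℕΣ.sum-remove f ⟨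
  ℕΣ.sum f                                             ≡⟨ count≡sum G p ⟨
  count G p                                            ∎
  where
  open ℕP.≤-Reasoning
  f : Fin (suc n) → ℕ
  f z = if p z then 1 else 0

sum-two-classes : ∀ {n} (G : Graph n) (p q r : Fin n → Bool) (v : Fin n → ℤ) α β →
  (∀ w → p w ≡ true → (q w ≡ true × r w ≡ false × v w ≡ α) ⊎ (q w ≡ false × r w ≡ true × v w ≡ β)) →
  sum (λ w → v w * 𝟙 (p w)) ≡ α * + count G (λ w → p w ∧ q w) + β * + count G (λ w → p w ∧ r w)
sum-two-classes G p q r v α β classes = begin
  sum (λ w → v w * 𝟙 (p w))
    ≡⟨ sum-cong-≋ (λ w → split (p w) (q w) (r w) (v w) (classes w)) ⟩
  sum (λ w → α * 𝟙 (p w ∧ q w) + β * 𝟙 (p w ∧ r w))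
    ≡⟨ sum-linear α β (λ w → 𝟙 (p w ∧ q w)) (λ w → 𝟙 (p w ∧ r w)) ⟩
  α * sum (λ w → 𝟙 (p w ∧ q w)) + β * sum (λ w → 𝟙 (p w ∧ r w))
    ≡⟨ cong₂ (λ x y → α * x + β * y) (count-ℤ G (λ w → p w ∧ q w)) (count-ℤ G (λ w → p w ∧ r w)) ⟨
  α * + count G (λ w → p w ∧ q w) + β * + count G (λ w → p w ∧ r w)       ∎
  where
  open ≡-Reasoning
  split : ∀ pb qb rb x → (pb ≡ true → (qb ≡ true × rb ≡ false × x ≡ α) ⊎ (qb ≡ false × rb ≡ true × x ≡ β)) →
          x * 𝟙 pb ≡ α * 𝟙 (pb ∧ qb) + β * 𝟙 (pb ∧ rb)
  split false qb rb x _ = trans (ℤP.*-zeroʳ x) (sym (cong₂ _+_ (ℤP.*-zeroʳ α) (ℤP.*-zeroʳ β)))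
  split true qb rb x h with h refl
  ... | inj₁ (refl , refl , refl) = sym (trans (cong (λ z → x * + 1 + z) (ℤP.*-zeroʳ β)) (ℤP.+-identityʳ _))
  ... | inj₂ (refl , refl , refl) = sym (trans (cong (λ z → z + x * + 1) (ℤP.*-zeroʳ α)) (ℤP.+-identityˡ _))

-- Distances

any-allFin⁺ : ∀ {n} (p : Fin n → Bool) z → p z ≡ true → any p (allFin n) ≡ true
any-allFin⁺ p z pz = to BoolP.T-≡ (any⁺ p (lose (∈-allFin z) (from BoolP.T-≡ pz)))

any-allFin⁻ : ∀ {n} (p : Fin n → Bool) → any p (allFin n) ≡ true → ∃[ z ] p z ≡ true
any-allFin⁻ p h with z , pz ← satisfied (any⁻ p (allFin _) (from BoolP.T-≡ h)) = z , to BoolP.T-≡ pz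

false≢true : false ≢ true
false≢true ()

module Distance {n} (G : Graph n) where

  within-refl : ∀ x → within G 0 x x ≡ true
  within-refl x = to BoolP.T-≡ (fromWitness refl)

  within-zero⇒≡ : ∀ x y → within G 0 x y ≡ true → x ≡ y
  within-zero⇒≡ x y h = toWitness (from BoolP.T-≡ h)

  within-suc : ∀ j x y → within G j x y ≡ true → within G (suc j) x y ≡ true
  within-suc j x y h = cong (_∨ any (λ z → adj G x z ∧ within G j z y) (allFin n)) h

  within-mono : ∀ {i j} x y → i ≤ j → within G i x y ≡ true → within G j x y ≡ true
  within-mono {j = zero} x y z≤n h = h
  within-mono {j = suc j} x y i≤1+j h with ℕP.m≤n⇒m<n∨m≡n i≤1+j
  ... | inj₁ i<1+j = within-suc j x y (within-mono x y (s≤s⁻¹ i<1+j) h)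
  ... | inj₂ refl  = h

  within-step : ∀ j x z y → adj G x z ≡ true → within G j z y ≡ true → within G (suc j) x y ≡ true
  within-step j x z y xz zy =
    trans (cong (within G j x y ∨_) (any-allFin⁺ (λ z → adj G x z ∧ within G j z y) z (cong₂ _∧_ xz zy)))
          (BoolP.∨-zeroʳ _)

  within-suc⁻ : ∀ j x y → within G (suc j) x y ≡ true → within G j x y ≡ false →
                ∃[ z ] adj G x z ≡ true × within G j z y ≡ true
  within-suc⁻ j x y h ¬h
    with z , pz ← any-allFin⁻ (λ z → adj G x z ∧ within G j z y)
                    (trans (cong (_∨ any (λ z → adj G x z ∧ within G j z y) (allFin n)) (sym ¬h)) h)
    = z , BoolP.∧-conicalˡ _ _ pz , BoolP.∧-conicalʳ _ _ pz

  isDist⇒within : ∀ i x y → isDist G i x y ≡ true → within G i x y ≡ true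
  isDist⇒within zero    x y h = h
  isDist⇒within (suc i) x y h = BoolP.∧-conicalˡ _ _ h

  isDist-suc⇒¬within : ∀ i x y → isDist G (suc i) x y ≡ true → within G i x y ≡ false
  isDist-suc⇒¬within i x y h = trans (sym (BoolP.not-involutive _)) (cong not (BoolP.∧-conicalʳ _ _ h))

  isDist-suc : ∀ i x y → within G (suc i) x y ≡ true → within G i x y ≡ false → isDist G (suc i) x y ≡ true
  isDist-suc i x y h ¬h = cong₂ (λ a b → a ∧ not b) h ¬h

  within⇒isDist : ∀ j x y → within G j x y ≡ true → Σ[ i ∈ ℕ ] i ≤ j × isDist G i x y ≡ true
  within⇒isDist zero x y h = 0 , z≤n , h
  within⇒isDist (suc j) x y h = by-cases (within G j x y) refl
    where
    by-cases : ∀ b → within G j x y ≡ b → Σ[ i ∈ ℕ ] i ≤ suc j × isDist G i x y ≡ true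
    by-cases true  eq with i , i≤j , d ← within⇒isDist j x y eq = i , ℕP.m≤n⇒m≤1+n i≤j , d
    by-cases false eq = suc j , ℕP.≤-refl , isDist-suc j x y h eq

  isDist-minimal : ∀ i j x y → isDist G i x y ≡ true → within G j x y ≡ true → i ≤ j
  isDist-minimal zero j x y _ _ = z≤n
  isDist-minimal (suc i) j x y d h with suc i ℕP.≤? j
  ... | yes i<j = i<j
  ... | no  i≮j = contradiction (trans (sym (isDist-suc⇒¬within i x y d)) (within-mono x y (s≤s⁻¹ (ℕP.≰⇒> i≮j)) h))
                              false≢true

  isDist-unique : ∀ i j x y → isDist G i x y ≡ true → isDist G j x y ≡ true → i ≡ j
  isDist-unique i j x y di dj = ℕP.≤-antisym (isDist-minimal i j x y di (isDist⇒within j x y dj))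
                                             (isDist-minimal j i x y dj (isDist⇒within i x y di))

  isDist-adjacent : ∀ i j z w y → adj G z w ≡ true → isDist G i z y ≡ true → isDist G j w y ≡ true → j ≤ suc i
  isDist-adjacent i j z w y zw dz dw =
    isDist-minimal j (suc i) w y dw (within-step i w z y (trans (adj-sym G w z) zw) (isDist⇒within i z y dz))

  isDist-down : ∀ i z y → isDist G (suc i) z y ≡ true → ∃[ z′ ] adj G z z′ ≡ true × isDist G i z′ y ≡ true
  isDist-down i z y d
    with z′ , zz′ , h ← within-suc⁻ i z y (isDist⇒within (suc i) z y d) (isDist-suc⇒¬within i z y d)
    with i′ , i′≤i , d′ ← within⇒isDist i z′ y h
    = z′ , zz′ , subst (λ j → isDist G j z′ y ≡ true) (ℕP.≤-antisym i′≤i i≤i′) d′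
    where
    i≤i′ : i ≤ i′
    i≤i′ = s≤s⁻¹ (isDist-minimal (suc i) (suc i′) z y d (within-step i′ z z′ y zz′ (isDist⇒within i′ z′ y d′)))

  module Bipartition (colour : Fin n → Bool) (proper : ∀ x y → adj G x y ≡ true → colour x ≢ colour y) where

    colour-layer : ∀ i z w y → isDist G i z y ≡ true → isDist G i w y ≡ true → colour z ≡ colour w
    colour-layer zero z w y dz dw = cong colour (trans (within-zero⇒≡ z y dz) (sym (within-zero⇒≡ w y dw)))
    colour-layer (suc i) z w y dz dw
      with z′ , zz′ , dz′ ← isDist-down i z y dz
      with w′ , ww′ , dw′ ← isDist-down i w y dw
      = begin
        colour z          ≡⟨ BoolP.¬-not (proper z z′ zz′) ⟩
        not (colour z′)   ≡⟨ cong not (colour-layer i z′ w′ y dz′ dw′) ⟩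
        not (colour w′)   ≡⟨ BoolP.¬-not (proper w w′ ww′) ⟨
        colour w          ∎
      where open ≡-Reasoning

    isDist-neighbour : ∀ i j z w y → adj G z w ≡ true → isDist G i z y ≡ true → isDist G j w y ≡ true →
                       j ≡ suc i ⊎ suc j ≡ i
    isDist-neighbour i j z w y zw dz dw with ℕP.<-cmp i j
    ... | tri< i<j _ _ = inj₁ (ℕP.≤-antisym (isDist-adjacent i j z w y zw dz dw) i<j)
    ... | tri≈ _ refl _ = contradiction (colour-layer i z w y dz dw) (proper z w zw)
    ... | tri> _ _ j<i = inj₂ (ℕP.≤-antisym j<i (isDist-adjacent j i w z y (trans (adj-sym G w z) zw) dw dz))

-- Bipartite distance-regular graphs

charMatrix : ∀ {n} → Graph n → ℤ → Matrix n
charMatrix G t x y = (if ⌊ x Fin.≟ y ⌋ then t else + 0) - adjMatrix G x y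

charMatrix-mulVec : ∀ {n} (G : Graph n) t (v : Fin n → ℤ) z →
  sum (λ w → v w * charMatrix G t z w) ≡ t * v z - sum (λ w → v w * 𝟙 (adj G z w))
charMatrix-mulVec {suc n} G t v z = begin
  sum (λ w → v w * charMatrix G t z w)
    ≡⟨ sum-cong-≋ (λ w → distrib (v w) (diag w) (𝟙 (adj G z w))) ⟩
  sum (λ w → + 1 * (v w * diag w) + (- + 1) * (v w * 𝟙 (adj G z w)))
    ≡⟨ sum-linear (+ 1) (- + 1) (λ w → v w * diag w) (λ w → v w * 𝟙 (adj G z w)) ⟩
  + 1 * sum (λ w → v w * diag w) + (- + 1) * sum (λ w → v w * 𝟙 (adj G z w))
    ≡⟨ cong (λ x → + 1 * x + (- + 1) * sum (λ w → v w * 𝟙 (adj G z w))) (sum-single (λ w → v w * diag w) z off-diagonal≡0) ⟩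
  + 1 * (v z * diag z) + (- + 1) * sum (λ w → v w * 𝟙 (adj G z w))
    ≡⟨ cong (λ x → + 1 * (v z * x) + (- + 1) * sum (λ w → v w * 𝟙 (adj G z w))) (diag-self) ⟩
  + 1 * (v z * t) + (- + 1) * sum (λ w → v w * 𝟙 (adj G z w))
    ≡⟨ tidy (v z) t (sum (λ w → v w * 𝟙 (adj G z w))) ⟩
  t * v z - sum (λ w → v w * 𝟙 (adj G z w))                                 ∎
  where
  open ≡-Reasoning
  diag : Fin (suc n) → ℤ
  diag w = if ⌊ z Fin.≟ w ⌋ then t else + 0
  diag-self : diag z ≡ t
  diag-self with z Fin.≟ z
  ... | yes _ = refl
  ... | no z≢z = contradiction refl z≢z
  off-diagonal≡0 : ∀ w → w ≢ z → v w * diag w ≡ + 0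
  off-diagonal≡0 w w≢z with z Fin.≟ w
  ... | yes z≡w = contradiction (sym z≡w) w≢z
  ... | no _ = ℤP.*-zeroʳ (v w)
  distrib : ∀ x a b → x * (a - b) ≡ + 1 * (x * a) + (- + 1) * (x * b)
  distrib = solve-∀
  tidy : ∀ x t s → + 1 * (x * t) + (- + 1) * s ≡ t * x - s
  tidy = solve-∀

cong₃ : ∀ {A : Set} (f : ℤ → ℤ → ℤ → A) {x x′ y y′ z z′} → x ≡ x′ → y ≡ y′ → z ≡ z′ → f x y z ≡ f x′ y′ z′
cong₃ f refl refl refl = refl

module StandardSequence (b c : ℕ → ℕ) where

  Q : ℤ → ℕ → ℤ
  Q t zero = + 1
  Q t (suc zero) = t
  Q t (suc (suc i)) = t * Q t (suc i) - + b i * + c (suc i) * Q t i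

  bProduct : ℕ → ℕ → ℤ
  bProduct i zero = + 1
  bProduct i (suc m) = + b i * bProduct (suc i) m

  tailProduct : ℕ → ℕ → ℤ
  tailProduct d i = bProduct i (d ∸ i)

  -- γ t d i = u_i(t) b_0 ⋯ b_{d-1} for the standard sequence u_i = Q_i / (b_0 ⋯ b_{i-1}); the scaling
  -- makes it integral.
  γ : ℤ → ℕ → ℕ → ℤ
  γ t d i = Q t i * tailProduct d i

  tailProduct-step : ∀ {d i} → i < d → tailProduct d i ≡ + b i * tailProduct d (suc i)
  tailProduct-step {d} {i} i<d = cong (bProduct i) (ℕP.+-∸-assoc 1 i<d)

  tailProduct-top : ∀ d → tailProduct d d ≡ + 1
  tailProduct-top d = cong (bProduct d) (ℕP.n∸n≡0 d)

  γ-recurrence-below : c 0 ≡ 0 → ∀ t {d} i → i < d →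
    t * γ t d i - (γ t d (pred i) * + c i + γ t d (suc i) * + b i) ≡ + 0
  γ-recurrence-below c₀≡0 t {d} zero 0<d = begin
    t * (+ 1 * B 0) - (+ 1 * B 0 * + c 0 + t * B 1 * + b 0)
      ≡⟨ cong₂ (λ x z → t * (+ 1 * x) - (+ 1 * x * z + t * B 1 * + b 0)) (tailProduct-step 0<d) (cong +_ c₀≡0) ⟩
    t * (+ 1 * (+ b 0 * B 1)) - (+ 1 * (+ b 0 * B 1) * + 0 + t * B 1 * + b 0)
      ≡⟨ identity t (+ b 0) (B 1) ⟩
    + 0 ∎
    where
    open ≡-Reasoning
    B = tailProduct d
    identity : ∀ t b₀ X → t * (+ 1 * (b₀ * X)) - (+ 1 * (b₀ * X) * + 0 + t * X * b₀) ≡ + 0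
    identity = solve-∀
  γ-recurrence-below c₀≡0 t {d} (suc j) j+1<d = begin
    t * (Q t (suc j) * B (suc j)) - (Q t j * B j * + c (suc j) + Q t (suc (suc j)) * B (suc (suc j)) * + b (suc j))
      ≡⟨ cong₂ (λ x y → t * (Q t (suc j) * x) - (Q t j * y * + c (suc j) + Q t (suc (suc j)) * B (suc (suc j)) * + b (suc j)))
               B₁≡ (trans (tailProduct-step (ℕP.<-trans (ℕP.n<1+n j) j+1<d)) (cong (+ b j *_) B₁≡)) ⟩
    t * (Q t (suc j) * (+ b (suc j) * X))
      - (Q t j * (+ b j * (+ b (suc j) * X)) * + c (suc j) + (t * Q t (suc j) - + b j * + c (suc j) * Q t j) * X * + b (suc j))
      ≡⟨ identity t (Q t j) (Q t (suc j)) (+ b j) (+ b (suc j)) (+ c (suc j)) X ⟩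
    + 0 ∎
    where
    open ≡-Reasoning
    B = tailProduct d
    X = B (suc (suc j))
    B₁≡ : B (suc j) ≡ + b (suc j) * X
    B₁≡ = tailProduct-step j+1<d
    identity : ∀ t q₀ q₁ b₀ b₁ c₁ X →
      t * (q₁ * (b₁ * X)) - (q₀ * (b₀ * (b₁ * X)) * c₁ + (t * q₁ - b₀ * c₁ * q₀) * X * b₁) ≡ + 0
    identity = solve-∀

  γ-recurrence-top : c 0 ≡ 0 → ∀ t d → b d ≡ 0 →
    t * γ t d d - (γ t d (pred d) * + c d + γ t d (suc d) * + b d) ≡ Q t (suc d)
  γ-recurrence-top c₀≡0 t zero b₀≡0 = begin
    t * (+ 1 * B 0) - (+ 1 * B 0 * + c 0 + t * B 1 * + b 0)
      ≡⟨ cong₃ (λ x z w → t * (+ 1 * x) - (+ 1 * x * z + t * B 1 * w)) (tailProduct-top 0) (cong +_ c₀≡0) (cong +_ b₀≡0) ⟩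
    t * (+ 1 * + 1) - (+ 1 * + 1 * + 0 + t * B 1 * + 0)
      ≡⟨ identity t (B 1) ⟩
    t ∎
    where
    open ≡-Reasoning
    B = tailProduct 0
    identity : ∀ t X → t * (+ 1 * + 1) - (+ 1 * + 1 * + 0 + t * X * + 0) ≡ t
    identity = solve-∀
  γ-recurrence-top c₀≡0 t (suc j) b≡0 = begin
    t * (Q t (suc j) * B (suc j)) - (Q t j * B j * + c (suc j) + Q t (suc (suc j)) * B (suc (suc j)) * + b (suc j))
      ≡⟨ cong₃ (λ x y z → t * (Q t (suc j) * x) - (Q t j * y * + c (suc j) + Q t (suc (suc j)) * B (suc (suc j)) * z))
               (tailProduct-top (suc j)) (trans (tailProduct-step (ℕP.n<1+n j)) (cong (+ b j *_) (tailProduct-top (suc j))))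
               (cong +_ b≡0) ⟩
    t * (Q t (suc j) * + 1) - (Q t j * (+ b j * + 1) * + c (suc j) + Q t (suc (suc j)) * B (suc (suc j)) * + 0)
      ≡⟨ identity t (Q t j) (Q t (suc j)) (+ b j) (+ c (suc j)) (Q t (suc (suc j)) * B (suc (suc j))) ⟩
    t * Q t (suc j) - + b j * + c (suc j) * Q t j ∎
    where
    open ≡-Reasoning
    B = tailProduct (suc j)
    identity : ∀ t q₀ q₁ b₀ c₁ Y → t * (q₁ * + 1) - (q₀ * (b₀ * + 1) * c₁ + Y * + 0) ≡ t * q₁ - b₀ * c₁ * q₀
    identity = solve-∀

module BipartiteDistanceRegular {n} (G : Graph n) {k} (regular : Regular G k) (bipartite : Bipartite G)
  (distance-regular : DistanceRegular G) (d : ℕ) (diameter : HasDiameter G d) where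

  open Distance G
  open Bipartition (proj₁ bipartite) (proj₂ bipartite)

  b : ℕ → ℕ
  b i = proj₁ (proj₁ (proj₂ distance-regular) i)

  -- Defs provides c_{i+1} as the i-th witness; c_0 = 0 makes c-count uniform in i, since for
  -- i = 0 it counts the neighbours of y at distance pred 0 = 0, that is, none.
  c : ℕ → ℕ
  c zero    = 0
  c (suc i) = proj₁ (proj₂ (proj₂ distance-regular) i)

  b-count : ∀ i z y → isDist G i z y ≡ true → count G (λ w → adj G z w ∧ isDist G (suc i) w y) ≡ b i
  b-count i = proj₂ (proj₁ (proj₂ distance-regular) i)

  c-count : ∀ i z y → isDist G i z y ≡ true → count G (λ w → adj G z w ∧ isDist G (pred i) w y) ≡ c i
  c-count zero z y dz = count-zero G _ no-loop
    where
    no-loop : ∀ w → (adj G z w ∧ isDist G 0 w y) ≡ false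
    no-loop w with isDist G 0 w y in dw
    ... | false = BoolP.∧-zeroʳ (adj G z w)
    ... | true rewrite within-zero⇒≡ w y dw | within-zero⇒≡ z y dz = trans (BoolP.∧-identityʳ (adj G y y)) (irrefl G y)
  c-count (suc i) = proj₂ (proj₂ (proj₂ distance-regular) i)

  dist : Fin n → Fin n → ℕ
  dist x y = proj₁ (within⇒isDist d x y (proj₁ diameter x y))

  isDist-dist : ∀ x y → isDist G (dist x y) x y ≡ true
  isDist-dist x y = proj₂ (proj₂ (within⇒isDist d x y (proj₁ diameter x y)))

  dist-≤ : ∀ x y → dist x y ≤ d
  dist-≤ x y = proj₁ (proj₂ (within⇒isDist d x y (proj₁ diameter x y)))

  dist-unique : ∀ {i} x y → isDist G i x y ≡ true → dist x y ≡ i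
  dist-unique x y = isDist-unique _ _ x y (isDist-dist x y)

  dist⇒isDist : ∀ {i} x y → dist x y ≡ i → isDist G i x y ≡ true
  dist⇒isDist x y e = subst (λ i → isDist G i x y ≡ true) e (isDist-dist x y)

  isDist-≢ : ∀ {i} x y → dist x y ≢ i → isDist G i x y ≡ false
  isDist-≢ {i} x y d≢i with isDist G i x y in di
  ... | true  = contradiction (dist-unique x y di) d≢i
  ... | false = refl

  sum-neighbours : ∀ (f : ℕ → ℤ) z y →
    sum (λ w → f (dist w y) * 𝟙 (adj G z w)) ≡ f (pred (dist z y)) * + c (dist z y) + f (suc (dist z y)) * + b (dist z y)
  sum-neighbours f z y = begin
    sum (λ w → f (dist w y) * 𝟙 (adj G z w))
      ≡⟨ sum-two-classes G (adj G z) (λ w → isDist G (pred i) w y) (λ w → isDist G (suc i) w y)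
                         (λ w → f (dist w y)) (f (pred i)) (f (suc i)) classes ⟩
    f (pred i) * + count G (λ w → adj G z w ∧ isDist G (pred i) w y)
      + f (suc i) * + count G (λ w → adj G z w ∧ isDist G (suc i) w y)
      ≡⟨ cong₂ (λ x y → f (pred i) * + x + f (suc i) * + y) (c-count i z y dz) (b-count i z y dz) ⟩
    f (pred i) * + c i + f (suc i) * + b i ∎
    where
    open ≡-Reasoning
    i = dist z y
    dz = isDist-dist z y
    pred≢suc : pred i ≢ suc i
    pred≢suc = ℕP.<⇒≢ (s≤s ℕP.pred[n]≤n)
    classes : ∀ w → adj G z w ≡ true →
      (isDist G (pred i) w y ≡ true × isDist G (suc i) w y ≡ false × f (dist w y) ≡ f (pred i)) ⊎
      (isDist G (pred i) w y ≡ false × isDist G (suc i) w y ≡ true × f (dist w y) ≡ f (suc i))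
    classes w zw with isDist-neighbour i (dist w y) z w y zw dz (isDist-dist w y)
    ... | inj₁ farther =
      inj₂ (isDist-≢ w y (λ closer → pred≢suc (trans (sym closer) farther)) , dist⇒isDist w y farther , cong f farther)
    ... | inj₂ 1+w≡z =
      inj₁ (dist⇒isDist w y closer , isDist-≢ w y (λ farther → pred≢suc (trans (sym closer) farther)) , cong f closer)
      where
      closer : dist w y ≡ pred i
      closer = cong pred 1+w≡z

  x₀ y₀ : Fin n
  x₀ = proj₁ (proj₂ diameter)
  y₀ = proj₁ (proj₂ (proj₂ diameter))

  x₀-antipodal : isDist G d x₀ y₀ ≡ true
  x₀-antipodal = proj₂ (proj₂ (proj₂ diameter))

  layer-inhabited : ∀ {i} → i ≤ d → ∃[ z ] isDist G i z y₀ ≡ true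
  layer-inhabited = descend d x₀ x₀-antipodal
    where
    descend : ∀ j x → isDist G j x y₀ ≡ true → ∀ {i} → i ≤ j → ∃[ z ] isDist G i z y₀ ≡ true
    descend j x dx i≤j with ℕP.m≤n⇒m<n∨m≡n i≤j
    descend j x dx i≤j | inj₂ refl = x , dx
    descend (suc j) x dx i≤j | inj₁ (s≤s i≤j′) with x′ , _ , dx′ ← isDist-down j x y₀ dx = descend j x′ dx′ i≤j′

  c+b≡k : ∀ {i} → i ≤ d → c i ℕ.+ b i ≡ k
  c+b≡k {i} i≤d with z , dz ← layer-inhabited i≤d = ℤP.+-injective (begin
    + (c i ℕ.+ b i)                                 ≡⟨ ℤP.pos-+ (c i) (b i) ⟩
    + c i + + b i
      ≡⟨ cong₂ _+_ (ℤP.*-identityˡ (+ c i)) (ℤP.*-identityˡ (+ b i)) ⟨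
    + 1 * + c i + + 1 * + b i
      ≡⟨ cong (λ j → + 1 * + c j + + 1 * + b j) (dist-unique {i} z y₀ dz) ⟨
    + 1 * + c (dist z y₀) + + 1 * + b (dist z y₀)   ≡⟨ sum-neighbours (λ _ → + 1) z y₀ ⟨
    sum (λ w → + 1 * 𝟙 (adj G z w))                 ≡⟨ sum-cong-≋ (λ w → ℤP.*-identityˡ (𝟙 (adj G z w))) ⟩
    sum (λ w → 𝟙 (adj G z w))                       ≡⟨ count-ℤ G (adj G z) ⟨
    + count G (adj G z)                             ≡⟨ cong +_ (regular z) ⟩
    + k                                             ∎)
    where open ≡-Reasoning

  b-top : b d ≡ 0
  b-top = trans (sym (b-count d x₀ y₀ x₀-antipodal)) (count-zero G _ beyond-diameter)
    where
    beyond-diameter : ∀ w → (adj G x₀ w ∧ isDist G (suc d) w y₀) ≡ false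
    beyond-diameter w = trans (cong (adj G x₀ w ∧_) (isDist-≢ w y₀ (ℕP.<⇒≢ (s≤s (dist-≤ w y₀)))))
                              (BoolP.∧-zeroʳ (adj G x₀ w))

  b-positive : ∀ {i} → i < d → 0 < b i
  b-positive {i} i<d
    with z , dz ← layer-inhabited i<d
    with z′ , zz′ , dz′ ← isDist-down i z y₀ dz
    = subst (0 <_) (b-count i z′ y₀ dz′) (count-positive G _ z (cong₂ _∧_ (trans (adj-sym G z′ z) zz′) dz))

  c-one : 0 < d → c 1 ≡ 1
  c-one 0<d
    with z , dz ← layer-inhabited 0<d
    with z′ , zz′ , dz′ ← isDist-down 0 z y₀ dz
    = trans (sym (c-count 1 z y₀ dz)) (count-single G _ y₀ z~y₀ only-y₀)
    where
    z~y₀ : (adj G z y₀ ∧ isDist G 0 y₀ y₀) ≡ true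
    z~y₀ = cong₂ _∧_ (subst (λ u → adj G z u ≡ true) (within-zero⇒≡ z′ y₀ dz′) zz′) (within-refl y₀)
    only-y₀ : ∀ w → w ≢ y₀ → (adj G z w ∧ isDist G 0 w y₀) ≡ false
    only-y₀ w w≢y₀ = trans (cong (adj G z w ∧_) (isDist-≢ {0} w y₀ (w≢y₀ ∘ within-zero⇒≡ w y₀ ∘ dist⇒isDist w y₀)))
                           (BoolP.∧-zeroʳ (adj G z w))

  open StandardSequence b c public

  charMatrix-standardVector : ∀ t y z →
    sum (λ w → γ t d (dist w y) * charMatrix G t z w) ≡ Q t (suc d) * 𝟙 (isDist G d z y)
  charMatrix-standardVector t y z = begin
    sum (λ w → γ t d (dist w y) * charMatrix G t z w)
      ≡⟨ charMatrix-mulVec G t (λ w → γ t d (dist w y)) z ⟩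
    t * γ t d i - sum (λ w → γ t d (dist w y) * 𝟙 (adj G z w))
      ≡⟨ cong (λ s → t * γ t d i - s) (sum-neighbours (γ t d) z y) ⟩
    t * γ t d i - (γ t d (pred i) * + c i + γ t d (suc i) * + b i) ≡⟨ by-layer (ℕP.m≤n⇒m<n∨m≡n (dist-≤ z y)) ⟩
    Q t (suc d) * 𝟙 (isDist G d z y)                               ∎
    where
    open ≡-Reasoning
    i = dist z y
    by-layer : i < d ⊎ i ≡ d → t * γ t d i - (γ t d (pred i) * + c i + γ t d (suc i) * + b i) ≡ Q t (suc d) * 𝟙 (isDist G d z y)
    by-layer (inj₁ i<d) = begin
      t * γ t d i - (γ t d (pred i) * + c i + γ t d (suc i) * + b i) ≡⟨ γ-recurrence-below refl t i i<d ⟩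
      + 0                                                            ≡⟨ ℤP.*-zeroʳ (Q t (suc d)) ⟨
      Q t (suc d) * + 0
        ≡⟨ cong (λ x → Q t (suc d) * 𝟙 x) (isDist-≢ z y (ℕP.<⇒≢ i<d)) ⟨
      Q t (suc d) * 𝟙 (isDist G d z y)                               ∎
    by-layer (inj₂ i≡d) = begin
      t * γ t d i - (γ t d (pred i) * + c i + γ t d (suc i) * + b i)
        ≡⟨ cong (λ j → t * γ t d j - (γ t d (pred j) * + c j + γ t d (suc j) * + b j)) i≡d ⟩
      t * γ t d d - (γ t d (pred d) * + c d + γ t d (suc d) * + b d) ≡⟨ γ-recurrence-top refl t d b-top ⟩
      Q t (suc d)                                                    ≡⟨ ℤP.*-identityʳ (Q t (suc d)) ⟨
      Q t (suc d) * + 1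
        ≡⟨ cong (λ x → Q t (suc d) * 𝟙 x) (dist⇒isDist z y i≡d) ⟨
      Q t (suc d) * 𝟙 (isDist G d z y)                               ∎

  charPoly-divisible : ∀ t → ∃[ D ] tailProduct d 0 * charPolyAt G t ≡ Q t (suc d) * D
  charPoly-divisible t = det (replaceCol M y₀ (λ r → 𝟙 (isDist G d r y₀))) , (begin
    tailProduct d 0 * det M
      ≡⟨ cong (_* det M) (ℤP.*-identityˡ (tailProduct d 0)) ⟨
    γ t d 0 * det M
      ≡⟨ cong (λ i → γ t d i * det M) (dist-unique {0} y₀ y₀ (within-refl y₀)) ⟨
    γ t d (dist y₀ y₀) * det M                                    ≡⟨ cramer M y₀ v ⟨
    det (replaceCol M y₀ (λ r → sum (λ w → v w * M r w)))
      ≡⟨ det-cong (replaceCol-cong M y₀ (charMatrix-standardVector t y₀)) ⟩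
    det (replaceCol M y₀ (λ r → Q t (suc d) * 𝟙 (isDist G d r y₀)))
      ≡⟨ det-homogeneous M y₀ (Q t (suc d)) (λ r → 𝟙 (isDist G d r y₀)) ⟩
    Q t (suc d) * det (replaceCol M y₀ (λ r → 𝟙 (isDist G d r y₀))) ∎)
    where
    open ≡-Reasoning
    M : Matrix n
    M = charMatrix G t
    v : Fin n → ℤ
    v w = γ t d (dist w y₀)

  tailProduct-nonzero : tailProduct d 0 ≢ + 0
  tailProduct-nonzero = bProduct-nonzero 0 d ℕP.≤-refl
    where
    bProduct-nonzero : ∀ i m → i ℕ.+ m ≤ d → bProduct i m ≢ + 0
    bProduct-nonzero i zero    _ ()
    bProduct-nonzero i (suc m) i+m<d b*rest≡0 with ℤP.i*j≡0⇒i≡0∨j≡0 (+ b i) b*rest≡0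
    ... | inj₁ bᵢ≡0 = ℕP.<⇒≢ (b-positive (ℕP.<-≤-trans (ℕP.m<m+n i (s≤s z≤n)) i+m<d)) (sym (ℤP.+-injective bᵢ≡0))
    ... | inj₂ rest≡0 = bProduct-nonzero (suc i) m (subst (_≤ d) (ℕP.+-suc i m) i+m<d) rest≡0

-- Reduction modulo t² - s

linear-nonvanishing : ∀ α β T → ∣ α ∣ < T → ¬ (α ≡ + 0 × β ≡ + 0) → α + β * + T ≢ + 0
linear-nonvanishing α β T ∣α∣<T αβ≢0 u≡0 with β ℤ.≟ + 0
... | yes β≡0 = αβ≢0 (trans (sym (trans (cong (λ x → α + x * + T) β≡0) (ℤP.+-identityʳ α))) u≡0 , β≡0)
... | no β≢0 = ℕP.<-irrefl refl (begin-strict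
  ∣ α ∣             <⟨ ∣α∣<T ⟩
  T                 ≤⟨ ℕP.m≤n*m T ∣ β ∣ {{ℕ.≢-nonZero (β≢0 ∘ ℤP.∣i∣≡0⇒i≡0)}} ⟩
  ∣ β ∣ ℕ.* T       ≡⟨ ℤP.abs-* β (+ T) ⟨
  ∣ β * + T ∣       ≡⟨ ℤP.∣-i∣≡∣i∣ (β * + T) ⟨
  ∣ - (β * + T) ∣   ≡⟨ cong ∣_∣ (inverseˡ-unique α (β * + T) u≡0) ⟨
  ∣ α ∣             ∎)
  where open ℕP.≤-Reasoning

∣B*linear∣≤ : ∀ B α β T .{{_ : ℕ.NonZero T}} → ∣ B * (α + β * + T) ∣ ≤ ∣ B ∣ ℕ.* (∣ α ∣ ℕ.+ ∣ β ∣) ℕ.* T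
∣B*linear∣≤ B α β T = begin
  ∣ B * (α + β * + T) ∣                     ≡⟨ ℤP.abs-* B (α + β * + T) ⟩
  ∣ B ∣ ℕ.* ∣ α + β * + T ∣                 ≤⟨ ℕP.*-monoʳ-≤ ∣ B ∣ (ℤP.∣i+j∣≤∣i∣+∣j∣ α (β * + T)) ⟩
  ∣ B ∣ ℕ.* (∣ α ∣ ℕ.+ ∣ β * + T ∣)         ≡⟨ cong (λ x → ∣ B ∣ ℕ.* (∣ α ∣ ℕ.+ x)) (ℤP.abs-* β (+ T)) ⟩
  ∣ B ∣ ℕ.* (∣ α ∣ ℕ.+ ∣ β ∣ ℕ.* T)         ≤⟨ ℕP.*-monoʳ-≤ ∣ B ∣ (ℕP.+-monoˡ-≤ (∣ β ∣ ℕ.* T) (ℕP.m≤m*n ∣ α ∣ T)) ⟩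
  ∣ B ∣ ℕ.* (∣ α ∣ ℕ.* T ℕ.+ ∣ β ∣ ℕ.* T)   ≡⟨ factor (∣ B ∣) (∣ α ∣) (∣ β ∣) T ⟩
  ∣ B ∣ ℕ.* (∣ α ∣ ℕ.+ ∣ β ∣) ℕ.* T         ∎
  where
  open ℕP.≤-Reasoning
  factor : ∀ x a b T → x ℕ.* (a ℕ.* T ℕ.+ b ℕ.* T) ≡ x ℕ.* (a ℕ.+ b) ℕ.* T
  factor = ℕSolver.solve-∀

linear<square : ∀ C s T → C ℕ.+ s < T → C ℕ.* T ℕ.+ s < T ℕ.* T
linear<square C s T@(suc _) C+s<T = begin-strict
  C ℕ.* T ℕ.+ s                 ≤⟨ ℕP.+-monoʳ-≤ (C ℕ.* T) (ℕP.m≤m*n s T) ⟩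
  C ℕ.* T ℕ.+ s ℕ.* T           <⟨ ℕP.m<m+n _ (s≤s z≤n) ⟩
  C ℕ.* T ℕ.+ s ℕ.* T ℕ.+ T     ≡⟨ factor C s T ⟩
  suc (C ℕ.+ s) ℕ.* T           ≤⟨ ℕP.*-monoˡ-≤ T C+s<T ⟩
  T ℕ.* T                       ∎
  where
  open ℕP.≤-Reasoning
  factor : ∀ C s T → C ℕ.* T ℕ.+ s ℕ.* T ℕ.+ T ≡ suc (C ℕ.+ s) ℕ.* T
  factor = ℕSolver.solve-∀

∣divisor∣≤ : ∀ x m W → x ≢ + 0 → x ≡ m * W → ∣ m ∣ ≤ ∣ x ∣
∣divisor∣≤ x m W x≢0 x≡mW = ∣⇒≤ {{ℕ.≢-nonZero (x≢0 ∘ ℤP.∣i∣≡0⇒i≡0)}}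
  (divides ∣ W ∣ (trans (cong ∣_∣ x≡mW) (trans (ℤP.abs-* m W) (ℕP.*-comm ∣ m ∣ ∣ W ∣))))

-- T is chosen so that α + β T ≠ 0 while |B (α + β T)| < T² - |s| ≤ |T² - s|.
nonzero-residue-not-divisible : ∀ s B α β → B ≢ + 0 → ¬ (α ≡ + 0 × β ≡ + 0) →
  ∃[ t ] ¬ (∃[ W ] B * (α + β * t) ≡ (t * t - s) * W)
nonzero-residue-not-divisible s B α β B≢0 αβ≢0 = + T , λ (W , Bu≡mW) → ℕP.<-irrefl refl (begin-strict
  T ℕ.* T                         ≡⟨ cong ∣_∣ (trans (ℤP.pos-* T T) (sym (cancel (+ T * + T) s))) ⟩
  ∣ + T * + T - s + s ∣           ≤⟨ ℤP.∣i+j∣≤∣i∣+∣j∣ (+ T * + T - s) s ⟩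
  ∣ + T * + T - s ∣ ℕ.+ ∣ s ∣     ≤⟨ ℕP.+-monoˡ-≤ ∣ s ∣ (∣divisor∣≤ (B * u) (+ T * + T - s) W Bu≢0 Bu≡mW) ⟩
  ∣ B * u ∣ ℕ.+ ∣ s ∣             ≤⟨ ℕP.+-monoˡ-≤ ∣ s ∣ (∣B*linear∣≤ B α β T) ⟩
  C ℕ.* T ℕ.+ ∣ s ∣               <⟨ linear<square C ∣ s ∣ T (s≤s (ℕP.m≤m+n (C ℕ.+ ∣ s ∣) ∣ α ∣)) ⟩
  T ℕ.* T                         ∎)
  where
  open ℕP.≤-Reasoning
  C T : ℕ
  C = ∣ B ∣ ℕ.* (∣ α ∣ ℕ.+ ∣ β ∣)
  T = suc (C ℕ.+ ∣ s ∣ ℕ.+ ∣ α ∣)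
  u : ℤ
  u = α + β * + T
  Bu≢0 : B * u ≢ + 0
  Bu≢0 Bu≡0 = [ B≢0 , linear-nonvanishing α β T (s≤s (ℕP.m≤n+m ∣ α ∣ (C ℕ.+ ∣ s ∣))) αβ≢0 ]′ (ℤP.i*j≡0⇒i≡0∨j≡0 B Bu≡0)
  cancel : ∀ x s → x - s + s ≡ x
  cancel = solve-∀

linearProduct : List (ℤ × ℕ) → ℤ → ℤ
linearProduct []              t = + 1
linearProduct ((κ , m) ∷ fs) t = (t + κ) ^ m * linearProduct fs t

-- (a , b) stands for a + b √s, and ReducesTo t x (a , b) says x ≡ a + b t modulo t² - s:
-- reduction is a ring homomorphism to ℤ[√s], and the norm detects nonzero residues.
module QuadraticReduction (s : ℤ) where

  _·_ : ℤ × ℤ → ℤ × ℤ → ℤ × ℤ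
  (a , b) · (a′ , b′) = a * a′ + s * (b * b′) , a * b′ + b * a′

  _^ᵖ_ : ℤ × ℤ → ℕ → ℤ × ℤ
  P ^ᵖ zero  = + 1 , + 0
  P ^ᵖ suc e = P · (P ^ᵖ e)

  norm : ℤ × ℤ → ℤ
  norm (a , b) = a * a - s * (b * b)

  norm-· : ∀ P P′ → norm (P · P′) ≡ norm P * norm P′
  norm-· (a , b) (a′ , b′) = identity a b a′ b′ s
    where
    identity : ∀ a b a′ b′ s → (a * a′ + s * (b * b′)) * (a * a′ + s * (b * b′)) - s * ((a * b′ + b * a′) * (a * b′ + b * a′))
                             ≡ (a * a - s * (b * b)) * (a′ * a′ - s * (b′ * b′))
    identity = solve-∀

  norm-^ : ∀ P e → norm (P ^ᵖ e) ≡ norm P ^ e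
  norm-^ P zero    = cong (λ x → + 1 - x) (ℤP.*-zeroʳ s)
  norm-^ P (suc e) = trans (norm-· P (P ^ᵖ e)) (cong (norm P *_) (norm-^ P e))

  norm≢0⇒nonzero : ∀ α β → norm (α , β) ≢ + 0 → ¬ (α ≡ + 0 × β ≡ + 0)
  norm≢0⇒nonzero α β norm≢0 (refl , refl) = norm≢0 (cong (λ x → + 0 - x) (ℤP.*-zeroʳ s))

  ReducesTo : ℤ → ℤ → ℤ × ℤ → Set
  ReducesTo t x (a , b) = ∃[ Z ] x ≡ a + b * t + (t * t - s) * Z

  reduces-· : ∀ {t x y} P P′ → ReducesTo t x P → ReducesTo t y P′ → ReducesTo t (x * y) (P · P′)
  reduces-· {t} (a , b) (a′ , b′) (Z , refl) (Z′ , refl) = _ , identity a b a′ b′ t s Z Z′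
    where
    identity : ∀ a b a′ b′ t s Z Z′ →
      (a + b * t + (t * t - s) * Z) * (a′ + b′ * t + (t * t - s) * Z′) ≡
      (a * a′ + s * (b * b′)) + (a * b′ + b * a′) * t
        + (t * t - s) * (b * b′ + Z * (a′ + b′ * t) + Z′ * (a + b * t) + (t * t - s) * Z * Z′)
    identity = solve-∀

  reduces-one : ∀ t → ReducesTo t (+ 1) (+ 1 , + 0)
  reduces-one t = + 0 , identity t s
    where
    identity : ∀ t s → + 1 ≡ + 1 + + 0 * t + (t * t - s) * + 0
    identity = solve-∀

  reduces-^ : ∀ {t x} P e → ReducesTo t x P → ReducesTo t (x ^ e) (P ^ᵖ e)
  reduces-^ {t} P zero    _  = reduces-one t
  reduces-^ P (suc e) x↝P = reduces-· P (P ^ᵖ e) x↝P (reduces-^ P e x↝P)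

  reduces-linear : ∀ t κ → ReducesTo t (t + κ) (κ , + 1)
  reduces-linear t κ = + 0 , identity t κ s
    where
    identity : ∀ t κ s → t + κ ≡ κ + + 1 * t + (t * t - s) * + 0
    identity = solve-∀

  not-divisible : ∀ B P (f : ℤ → ℤ) → B ≢ + 0 → norm P ≢ + 0 → (∀ t → ReducesTo t (f t) P) →
                  ¬ (∀ t → ∃[ X ] B * f t ≡ (t * t - s) * X)
  not-divisible B (α , β) f B≢0 norm≢0 f↝P divisible
    with t , no-multiple ← nonzero-residue-not-divisible s B α β B≢0 (norm≢0⇒nonzero α β norm≢0)
    with X , BfX ← divisible t
    with Z , f≡ ← f↝P t
    = no-multiple (X - B * Z , (begin
      B * (α + β * t)                          ≡⟨ identity B (α + β * t) (t * t - s) Z ⟩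
      B * (α + β * t + (t * t - s) * Z) - (t * t - s) * (B * Z) ≡⟨ cong (λ x → B * x - (t * t - s) * (B * Z)) f≡ ⟨
      B * f t - (t * t - s) * (B * Z)          ≡⟨ cong (λ x → x - (t * t - s) * (B * Z)) BfX ⟩
      (t * t - s) * X - (t * t - s) * (B * Z)  ≡⟨ factor (t * t - s) X (B * Z) ⟩
      (t * t - s) * (X - B * Z)                ∎))
    where
    open ≡-Reasoning
    identity : ∀ B u m Z → B * u ≡ B * (u + m * Z) - m * (B * Z)
    identity = solve-∀
    factor : ∀ m X Y → m * X - m * Y ≡ m * (X - Y)
    factor = solve-∀

  residue : List (ℤ × ℕ) → ℤ × ℤ
  residue []             = + 1 , + 0
  residue ((κ , m) ∷ fs) = ((κ , + 1) ^ᵖ m) · residue fs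

  reduces-linearProduct : ∀ fs t → ReducesTo t (linearProduct fs t) (residue fs)
  reduces-linearProduct []             t = reduces-one t
  reduces-linearProduct ((κ , m) ∷ fs) t =
    reduces-· ((κ , + 1) ^ᵖ m) (residue fs) (reduces-^ (κ , + 1) m (reduces-linear t κ)) (reduces-linearProduct fs t)

  norm-residue≢0 : ∀ fs → All (λ f → proj₁ f * proj₁ f ≢ s) fs → norm (residue fs) ≢ + 0
  norm-residue≢0 [] [] norm≡0 with trans (sym (cong (λ x → + 1 * + 1 - x) (ℤP.*-zeroʳ s))) norm≡0
  ... | ()
  norm-residue≢0 ((κ , m) ∷ fs) (κ²≢s ∷ rest) norm≡0 =
    [ power≢0 , norm-residue≢0 fs rest ]′
      (ℤP.i*j≡0⇒i≡0∨j≡0 (norm ((κ , + 1) ^ᵖ m)) (trans (sym (norm-· ((κ , + 1) ^ᵖ m) (residue fs))) norm≡0))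
    where
    power≢0 : norm ((κ , + 1) ^ᵖ m) ≢ + 0
    power≢0 power≡0 = κ²≢s (trans (ℤP.i-j≡0⇒i≡j (κ * κ) (s * (+ 1 * + 1)) factor≡0) (ℤP.*-identityʳ s))
      where
      factor≡0 : norm (κ , + 1) ≡ + 0
      factor≡0 = ℤP.i^n≡0⇒i≡0 (norm (κ , + 1)) m (trans (sym (norm-^ (κ , + 1) m)) power≡0)

quadratic-not-dividing : ∀ s B fs → B ≢ + 0 → All (λ f → proj₁ f * proj₁ f ≢ s) fs →
  ¬ (∀ t → ∃[ X ] B * linearProduct fs t ≡ (t * t - s) * X)
quadratic-not-dividing s B fs B≢0 κ²≢s =
  not-divisible B (residue fs) (linearProduct fs) B≢0 (norm-residue≢0 fs κ²≢s) (reduces-linearProduct fs)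
  where open QuadraticReduction s

-- Diameter four

Q₅-factorisation : ∀ t k c₂ b₃ {p₀ p₁ p₂ p₃} →
  p₀ ≡ k → p₁ ≡ (k - + 1) * c₂ → p₂ ≡ (k - c₂) * (k - b₃) → p₃ ≡ b₃ * k →
  t * (t * (t * (t * t - p₀ * + 1) - p₁ * t) - p₂ * (t * t - p₀ * + 1)) - p₃ * (t * (t * t - p₀ * + 1) - p₁ * t)
    ≡ t * (t * t - k * k) * (t * t - (k + c₂ * (b₃ - + 1)))
Q₅-factorisation t k c₂ b₃ refl refl refl refl = identity t k c₂ b₃
  where
  identity : ∀ t k c₂ b₃ →
    t * (t * (t * (t * t - k * + 1) - (k - + 1) * c₂ * t) - (k - c₂) * (k - b₃) * (t * t - k * + 1))
      - b₃ * k * (t * (t * t - k * + 1) - (k - + 1) * c₂ * t)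
    ≡ t * (t * t - k * k) * (t * t - (k + c₂ * (b₃ - + 1)))
  identity = solve-∀

eigenvalueFactors : ℕ → ℕ → ℕ → ℕ → ℕ → ℕ → List (ℤ × ℕ)
eigenvalueFactors k m₀ m₁ m₂ m₃ m₄ = (+ 0 , m₀) ∷ (- + 1 , m₁) ∷ (+ 1 , m₂) ∷ (- + k , m₃) ∷ (+ k , m₄) ∷ []

charPoly-shape : ∀ t k m₀ m₁ m₂ m₃ m₄ →
  (t ^ m₀) * (((t - + 1) ^ m₁) * (((t + + 1) ^ m₂) * (((t - + k) ^ m₃) * ((t + + k) ^ m₄))))
    ≡ linearProduct (eigenvalueFactors k m₀ m₁ m₂ m₃ m₄) t
charPoly-shape t k m₀ m₁ m₂ m₃ m₄ =
  cong₂ (λ x y → x ^ m₀ * ((t - + 1) ^ m₁ * ((t + + 1) ^ m₂ * ((t - + k) ^ m₃ * y))))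
        (sym (ℤP.+-identityʳ t)) (sym (ℤP.*-identityʳ ((t + + k) ^ m₄)))

+-minus : ∀ m n {k} → m ℕ.+ n ≡ k → + n ≡ + k - + m
+-minus m n refl = sym (trans (cong (_- + m) (ℤP.pos-+ m n)) (identity (+ m) (+ n)))
  where
  identity : ∀ x y → x + y - x ≡ y
  identity = solve-∀

k+xy<k² : ∀ k x y → 2 ≤ k → x < k → y < k → k ℕ.+ x ℕ.* y < k ℕ.* k
k+xy<k² (suc zero) _ _ (s≤s ()) _ _
k+xy<k² k@(suc k′@(suc _)) x y _ (s≤s x≤k′) y<k = begin-strict
  k ℕ.+ x ℕ.* y     ≤⟨ ℕP.+-monoʳ-≤ k (ℕP.*-monoˡ-≤ y x≤k′) ⟩
  k ℕ.+ k′ ℕ.* y    <⟨ ℕP.+-monoʳ-< k (ℕP.*-monoʳ-< k′ y<k) ⟩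
  k ℕ.+ k′ ℕ.* k    ∎
  where open ℕP.≤-Reasoning

module Diameter4 {n} (G : Graph n) {k} (regular : Regular G k) (bipartite : Bipartite G)
  (distance-regular : DistanceRegular G) (diameter : HasDiameter G 4) where

  open BipartiteDistanceRegular G regular bipartite distance-regular 4 diameter public

  -- ±θ are the eigenvalues of the graph besides 0 and ±k.
  θ²ℕ : ℕ
  θ²ℕ = k ℕ.+ c 2 ℕ.* pred (b 3)

  θ² : ℤ
  θ² = + k + + c 2 * (+ b 3 - + 1)

  c₁≡1 : c 1 ≡ 1
  c₁≡1 = c-one (s≤s z≤n)

  b₃≡suc : b 3 ≡ suc (pred (b 3))
  b₃≡suc = sym (ℕP.suc-pred (b 3) {{ℕ.>-nonZero (b-positive (ℕP.n<1+n 3))}})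

  θ²≡θ²ℕ : θ² ≡ + θ²ℕ
  θ²≡θ²ℕ = begin
    + k + + c 2 * (+ b 3 - + 1)            ≡⟨ cong (λ x → + k + + c 2 * (+ x - + 1)) b₃≡suc ⟩
    + k + + c 2 * + pred (b 3)             ≡⟨ cong (λ x → + k + x) (ℤP.pos-* (c 2) (pred (b 3))) ⟨
    + k + + (c 2 ℕ.* pred (b 3))           ≡⟨ ℤP.pos-+ k (c 2 ℕ.* pred (b 3)) ⟨
    + θ²ℕ                                  ∎
    where open ≡-Reasoning

  2≤k : 2 ≤ k
  2≤k = subst (2 ≤_) (trans (cong (ℕ._+ b 1) (sym c₁≡1)) (c+b≡k (s≤s z≤n))) (s≤s (b-positive (s≤s (s≤s z≤n))))

  2≤θ²ℕ : 2 ≤ θ²ℕ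
  2≤θ²ℕ = ℕP.≤-trans 2≤k (ℕP.m≤m+n k _)

  θ²ℕ<k² : θ²ℕ < k ℕ.* k
  θ²ℕ<k² = k+xy<k² k (c 2) (pred (b 3)) 2≤k c₂<k b₃-1<k
    where
    c₂<k : c 2 < k
    c₂<k = subst (c 2 <_) (c+b≡k (s≤s (s≤s z≤n))) (ℕP.m<m+n (c 2) (b-positive (s≤s (s≤s (s≤s z≤n)))))
    b₃-1<k : pred (b 3) < k
    b₃-1<k = ℕP.<-≤-trans (subst (pred (b 3) <_) (sym b₃≡suc) ℕP.≤-refl)
                          (subst (b 3 ≤_) (c+b≡k (s≤s (s≤s (s≤s z≤n)))) (ℕP.m≤n+m (b 3) (c 3)))

  roots-avoid-θ² : ∀ m₀ m₁ m₂ m₃ m₄ → All (λ f → proj₁ f * proj₁ f ≢ θ²) (eigenvalueFactors k m₀ m₁ m₂ m₃ m₄)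
  roots-avoid-θ² _ _ _ _ _ =
    avoid (+ 0) 0 refl 0≢θ²ℕ ∷ avoid (- + 1) 1 refl 1≢θ²ℕ ∷ avoid (+ 1) 1 refl 1≢θ²ℕ
      ∷ avoid (- + k) (k ℕ.* k) k²≡ k²≢θ²ℕ ∷ avoid (+ k) (k ℕ.* k) (sym (ℤP.pos-* k k)) k²≢θ²ℕ ∷ []
    where
    avoid : ∀ κ m → κ * κ ≡ + m → m ≢ θ²ℕ → κ * κ ≢ θ²
    avoid κ m κ²≡m m≢θ² κ²≡θ² = m≢θ² (ℤP.+-injective (trans (sym κ²≡m) (trans κ²≡θ² θ²≡θ²ℕ)))
    0≢θ²ℕ : 0 ≢ θ²ℕ
    0≢θ²ℕ = ℕP.<⇒≢ (ℕP.≤-trans (s≤s z≤n) 2≤θ²ℕ)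
    1≢θ²ℕ : 1 ≢ θ²ℕ
    1≢θ²ℕ = ℕP.<⇒≢ 2≤θ²ℕ
    k²≢θ²ℕ : k ℕ.* k ≢ θ²ℕ
    k²≢θ²ℕ = ℕP.>⇒≢ θ²ℕ<k²
    k²≡ : (- + k) * (- + k) ≡ + (k ℕ.* k)
    k²≡ = trans (square-neg (+ k)) (sym (ℤP.pos-* k k))
      where
      square-neg : ∀ x → (- x) * (- x) ≡ x * x
      square-neg = solve-∀

  Q₅-factorises : ∀ t → Q t 5 ≡ t * (t * t - + k * + k) * (t * t - θ²)
  Q₅-factorises t = Q₅-factorisation t (+ k) (+ c 2) (+ b 3) p₀ p₁ p₂ p₃
    where
    p₀ : + b 0 * + c 1 ≡ + k
    p₀ = trans (cong₂ (λ x y → + x * + y) (c+b≡k z≤n) c₁≡1) (ℤP.*-identityʳ (+ k))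
    p₁ : + b 1 * + c 2 ≡ (+ k - + 1) * + c 2
    p₁ = cong (λ x → x * + c 2) (trans (+-minus (c 1) (b 1) (c+b≡k (s≤s z≤n))) (cong (λ x → + k - + x) c₁≡1))
    p₂ : + b 2 * + c 3 ≡ (+ k - + c 2) * (+ k - + b 3)
    p₂ = cong₂ _*_ (+-minus (c 2) (b 2) (c+b≡k (s≤s (s≤s z≤n))))
                   (+-minus (b 3) (c 3) (trans (ℕP.+-comm (b 3) (c 3)) (c+b≡k (s≤s (s≤s (s≤s z≤n))))))
    p₃ : + b 3 * + c 4 ≡ + b 3 * + k
    p₃ = cong (λ x → + b 3 * + x)
              (trans (sym (ℕP.+-identityʳ (c 4))) (trans (cong (c 4 ℕ.+_) (sym b-top)) (c+b≡k ℕP.≤-refl)))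

  θ²-divides : ∀ t → ∃[ X ] tailProduct 4 0 * charPolyAt G t ≡ (t * t - θ²) * X
  θ²-divides t with D , divisible ← charPoly-divisible t = t * (t * t - + k * + k) * D , (begin
    tailProduct 4 0 * charPolyAt G t               ≡⟨ divisible ⟩
    Q t 5 * D                                      ≡⟨ cong (_* D) (Q₅-factorises t) ⟩
    t * (t * t - + k * + k) * (t * t - θ²) * D     ≡⟨ rearrange (t * (t * t - + k * + k)) (t * t - θ²) D ⟩
    (t * t - θ²) * (t * (t * t - + k * + k) * D)   ∎)
    where
    open ≡-Reasoning
    rearrange : ∀ x y z → x * y * z ≡ y * (x * z)
    rearrange = solve-∀

lemma5p4 : (n k : ℕ) (G : Graph n) →
    ¬ (Bipartite G × DistanceRegular G × HasDiameter G 4 × Regular G k × EigenvaluesAre0±1±k G k)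
lemma5p4 n k G (bipartite , distance-regular , diameter , regular , m₀ , m₁ , m₂ , m₃ , m₄ , _ , _ , _ , _ , _ , χ≡) =
  quadratic-not-dividing θ² (tailProduct 4 0) (eigenvalueFactors k m₀ m₁ m₂ m₃ m₄)
    tailProduct-nonzero (roots-avoid-θ² m₀ m₁ m₂ m₃ m₄) divisible
  where
  open Diameter4 G regular bipartite distance-regular diameter
  divisible : ∀ t → ∃[ X ] tailProduct 4 0 * linearProduct (eigenvalueFactors k m₀ m₁ m₂ m₃ m₄) t ≡ (t * t - θ²) * X
  divisible t = subst (λ χ → ∃[ X ] tailProduct 4 0 * χ ≡ (t * t - θ²) * X)
                      (trans (χ≡ t) (charPoly-shape t k m₀ m₁ m₂ m₃ m₄)) (θ²-divides t)
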